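{- Let $\mathbb K$ be a field of characteristic zero, $\mathfrak d$ a delta operator on $\mathbb K[x]$, and $\mathfrak d^{ -1}$ a linear operator on $\mathbb K[x]$ with $\mathfrak d(\mathfrak d^{ -1}(f))=f$ for all $f$, $\deg\mathfrak d^{ -1}(f)=1+\deg f$ for $f\neq0$, and $\mathfrak d^{ -1}(f)(0)=0$. Let $\mathcal Z=(z_i)_{i\ge0}$ be a sequence in $\mathbb K$ and $(t_n(x))_{n\ge0}$ the generalized Gončarov basis associated with $(\mathfrak d,\mathcal Z)$. For $k\in\mathbb N$ let $(t_i^{(k)}(x))_{i\ge0}$ be the generalized Gončarov basis associated with $(\mathfrak d,\mathcal Z^{(k)})$, and let $\mathcal I_k$ be the linear operator $$\mathcal I_k=(1-\varepsilon_{z_0})\mathfrak d^{ -1}\circ(1-\varepsilon_{z_1})\mathfrak d^{ -1}\circ\cdots\circ(1-\varepsilon_{z_{k-1}})\mathfrak d^{ -1}$$ ($\mathcal I_0$ the identity). Then for all $n,k\in\mathbb N$ with $k\le n$, $t_n(x)=n_{(k)}\,\mathcal I_k\big(t^{(k)}_{n-k}(x)\big)$, where $n_{(k)}=n(n-1)\cdots(n-k+1)$.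
   Context: A shift-invariant operator on $\mathbb K[x]$ is a linear operator commuting with all shifts $f(x)\mapsto f(x+a)$; a delta operator is a shift-invariant operator $\mathfrak d$ with $\mathfrak d(x)$ a nonzero constant. Here $\varepsilon_z$ denotes the operator sending $f$ to the constant polynomial $f(z)$, and $1$ the identity, so $(1-\varepsilon_z)g=g-g(z)$. The shifted grid $\mathcal Z^{(k)}$ has $i$-th term $z_{i+k}$. For a sequence $\mathcal W=(w_i)_{i\ge0}$, the generalized Gončarov basis associated with $(\mathfrak d,\mathcal W)$ is the unique sequence of polynomials $(t_n)_{n\ge0}$ with $\deg t_n=n$ and $(\mathfrak d^i t_n)(w_i)=n!\,\delta_{i,n}$ for all $i,n$, $\mathfrak d^i$ the $i$-th iterate. -}

module Defs where

open import Level using (Level; _⊔_)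
open import Data.Nat using (ℕ; zero; suc; _<_; _∸_)
open import Data.List using (List; []; _∷_)
open import Data.Product using (Σ; _×_; _,_)
open import Relation.Nullary using (¬_)
open import Algebra.Bundles using (CommutativeRing)

record Field (c ℓ : Level) : Set (Level.suc (c ⊔ ℓ)) where
  field
    commutativeRing : CommutativeRing c ℓ
  open CommutativeRing commutativeRing public
  field
    1≉0 : ¬ (1# ≈ 0#)
    inverse : ∀ x → ¬ (x ≈ 0#) → Σ Carrier (λ y → x * y ≈ 1#)

falling : ℕ → ℕ → ℕ
falling n zero = 1
falling n (suc k) = (n ∸ k) Data.Nat.* falling n k

fact : ℕ → ℕ
fact zero = 1
fact (suc n) = suc n Data.Nat.* fact n

module Poly {c ℓ} (K : Field c ℓ) where
  open Field K

  fromℕ : ℕ → Carrier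
  fromℕ zero = 0#
  fromℕ (suc n) = 1# + fromℕ n

  CharZero : Set ℓ
  CharZero = ∀ n → ¬ (fromℕ (suc n) ≈ 0#)

  -- K[x]: coefficient lists, lowest degree first; equality is coefficientwise
  Pol : Set c
  Pol = List Carrier

  coeff : Pol → ℕ → Carrier
  coeff [] n = 0#
  coeff (a ∷ f) zero = a
  coeff (a ∷ f) (suc n) = coeff f n

  infix 4 _≈ₚ_
  _≈ₚ_ : Pol → Pol → Set ℓ
  f ≈ₚ g = ∀ n → coeff f n ≈ coeff g n

  0ₚ : Pol
  0ₚ = []

  const : Carrier → Pol
  const a = a ∷ []

  X : Pol
  X = 0# ∷ 1# ∷ []

  infixl 6 _+ₚ_
  _+ₚ_ : Pol → Pol → Pol
  [] +ₚ g = g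
  (a ∷ f) +ₚ [] = a ∷ f
  (a ∷ f) +ₚ (b ∷ g) = (a + b) ∷ (f +ₚ g)

  infixl 7 _·ₚ_
  _·ₚ_ : Carrier → Pol → Pol
  a ·ₚ [] = []
  a ·ₚ (b ∷ f) = (a * b) ∷ (a ·ₚ f)

  infixl 7 _*ₚ_
  _*ₚ_ : Pol → Pol → Pol
  [] *ₚ g = []
  (a ∷ f) *ₚ g = (a ·ₚ g) +ₚ (0# ∷ (f *ₚ g))

  eval : Carrier → Pol → Carrier
  eval z [] = 0#
  eval z (a ∷ f) = a + z * eval z f

  shift : Carrier → Pol → Pol
  shift a [] = []
  shift a (b ∷ f) = const b +ₚ ((a ∷ 1# ∷ []) *ₚ shift a f)

  HasDeg : Pol → ℕ → Set ℓ
  HasDeg f n = ¬ (coeff f n ≈ 0#) × (∀ m → n < m → coeff f m ≈ 0#)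

  Op : Set c
  Op = Pol → Pol

  record IsLinear (T : Op) : Set (c ⊔ ℓ) where
    field
      cong  : ∀ f g → f ≈ₚ g → T f ≈ₚ T g
      additive : ∀ f g → T (f +ₚ g) ≈ₚ T f +ₚ T g
      homogeneous : ∀ a f → T (a ·ₚ f) ≈ₚ a ·ₚ T f

  IsShiftInvariant : Op → Set (c ⊔ ℓ)
  IsShiftInvariant T = IsLinear T × (∀ a f → T (shift a f) ≈ₚ shift a (T f))

  IsDeltaOperator : Op → Set (c ⊔ ℓ)
  IsDeltaOperator D =
    IsShiftInvariant D × Σ Carrier (λ a → ¬ (a ≈ 0#) × D X ≈ₚ const a)

  iter : ℕ → Op → Op
  iter zero T f = f
  iter (suc i) T f = T (iter i T f)

  ε : Carrier → Op
  ε z f = const (eval z f)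

  1-ε : Carrier → Op
  1-ε z g = g +ₚ const (- eval z g)

  kronecker : ℕ → ℕ → Carrier
  kronecker zero zero = 1#
  kronecker zero (suc m) = 0#
  kronecker (suc n) zero = 0#
  kronecker (suc n) (suc m) = kronecker n m

  IsGoncarovBasis : Op → (ℕ → Carrier) → (ℕ → Pol) → Set ℓ
  IsGoncarovBasis D W t =
    (∀ n → HasDeg (t n) n) ×
    (∀ i n → eval (W i) (iter i D (t n)) ≈ fromℕ (fact n) * kronecker i n)

  Iop : Op → (ℕ → Carrier) → ℕ → Op
  Iop Dinv z zero g = g
  Iop Dinv z (suc k) g = Iop Dinv z k (1-ε (z k) (Dinv g))

-- A polynomial q of degree ≤ n is determined by its Gončarov data (𝔡ⁱ q)(wᵢ), i ≤ n:
-- write q = a + 𝔡⁻¹ g with deg g < n; then 𝔡 q = g is determined by the data on the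
-- shifted grid, and a by q(w₀). Since (m+1)(1 − ε_{w₀}) 𝔡⁻¹ t′ₘ has the same data as
-- t_{m+1} when t′ is the basis of the shifted grid, the two are equal; iterating this
-- recurrence k times produces the falling factorial and the operator I_k.
module Submission where

open import Defs
open import Data.Nat using (ℕ; suc; _≤_; _∸_) renaming (_+_ to _+ℕ_)
open import Data.Nat using (zero; z≤n; s≤s; _<_) renaming (_*_ to _*ℕ_)
import Data.Nat.Properties as ℕ
open import Data.List using ([]; _∷_)
open import Data.Product using (∃; ∃₂; _×_; _,_; proj₁; proj₂)
open import Data.Sum using (inj₁; inj₂)
open import Relation.Binary.Bundles using (Setoid)
import Relation.Binary.PropositionalEquality as ≡
import Relation.Binary.Reasoning.Setoid as SetoidReasoning
import Algebra.Properties.Ring as RingProperties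
import Algebra.Properties.Group as GroupProperties
import Algebra.Properties.CommutativeSemigroup as CommutativeSemigroupProperties

module GoncarovBases {c ℓ} (K : Field c ℓ) where
  open Field K hiding (zero)
  open Poly K
  open RingProperties ring using (-‿distribˡ-*; -‿distribʳ-*)
  open GroupProperties +-group using (identityʳ-unique; ∙-cancelʳ)
  open CommutativeSemigroupProperties +-commutativeSemigroup using (interchange)
  open CommutativeSemigroupProperties *-commutativeSemigroup using (x∙yz≈y∙xz; xy∙z≈x∙zy)
  module ≈-Reasoning = SetoidReasoning setoid

  fromℕ-+ : ∀ m n → fromℕ (m +ℕ n) ≈ fromℕ m + fromℕ n
  fromℕ-+ zero n = sym (+-identityˡ _)
  fromℕ-+ (suc m) n = trans (+-congˡ (fromℕ-+ m n)) (sym (+-assoc 1# _ _))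

  fromℕ-* : ∀ m n → fromℕ (m *ℕ n) ≈ fromℕ m * fromℕ n
  fromℕ-* zero n = sym (zeroˡ _)
  fromℕ-* (suc m) n = begin
    fromℕ (n +ℕ m *ℕ n)             ≈⟨ fromℕ-+ n (m *ℕ n) ⟩
    fromℕ n + fromℕ (m *ℕ n)        ≈⟨ +-cong (sym (*-identityˡ _)) (fromℕ-* m n) ⟩
    1# * fromℕ n + fromℕ m * fromℕ n ≈⟨ distribʳ (fromℕ n) 1# (fromℕ m) ⟨
    (1# + fromℕ m) * fromℕ n        ∎
    where open ≈-Reasoning

  -- Polynomial arithmetic up to coefficientwise equality

  -- Pointwise equality wrapped in a record: unlike ≈ₚ, whose unfolding goes through the
  -- non-injective coeff, a record type lets Agda infer the polynomials from a proof.
  infix 4 _≋_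
  record _≋_ (f g : Pol) : Set ℓ where
    constructor coeffwise
    field coeff≈ : f ≈ₚ g
  open _≋_ public

  ≋-refl : ∀ {f} → f ≋ f
  ≋-refl = coeffwise λ n → refl

  ≋-sym : ∀ {f g} → f ≋ g → g ≋ f
  ≋-sym p = coeffwise λ n → sym (coeff≈ p n)

  ≋-trans : ∀ {f g h} → f ≋ g → g ≋ h → f ≋ h
  ≋-trans p q = coeffwise λ n → trans (coeff≈ p n) (coeff≈ q n)

  polySetoid : Setoid c ℓ
  polySetoid = record
    { Carrier = Pol
    ; _≈_ = _≋_
    ; isEquivalence = record { refl = ≋-refl ; sym = ≋-sym ; trans = ≋-trans }
    }

  module ≋-Reasoning = SetoidReasoning polySetoid

  coeff-+ₚ : ∀ f g n → coeff (f +ₚ g) n ≈ coeff f n + coeff g n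
  coeff-+ₚ [] g n = sym (+-identityˡ _)
  coeff-+ₚ (a ∷ f) [] n = sym (+-identityʳ _)
  coeff-+ₚ (a ∷ f) (b ∷ g) zero = refl
  coeff-+ₚ (a ∷ f) (b ∷ g) (suc n) = coeff-+ₚ f g n

  coeff-·ₚ : ∀ a f n → coeff (a ·ₚ f) n ≈ a * coeff f n
  coeff-·ₚ a [] n = sym (zeroʳ a)
  coeff-·ₚ a (b ∷ f) zero = refl
  coeff-·ₚ a (b ∷ f) (suc n) = coeff-·ₚ a f n

  +ₚ-cong : ∀ {f f' g g'} → f ≋ f' → g ≋ g' → f +ₚ g ≋ f' +ₚ g'
  +ₚ-cong {f} {f'} {g} {g'} p q = coeffwise λ n →
    trans (coeff-+ₚ f g n) (trans (+-cong (coeff≈ p n) (coeff≈ q n)) (sym (coeff-+ₚ f' g' n)))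

  +ₚ-congˡ : ∀ f {g g'} → g ≋ g' → f +ₚ g ≋ f +ₚ g'
  +ₚ-congˡ f = +ₚ-cong (≋-refl {f})

  ·ₚ-cong : ∀ {a b f g} → a ≈ b → f ≋ g → a ·ₚ f ≋ b ·ₚ g
  ·ₚ-cong {a} {b} {f} {g} e p = coeffwise λ n →
    trans (coeff-·ₚ a f n) (trans (*-cong e (coeff≈ p n)) (sym (coeff-·ₚ b g n)))

  ·ₚ-congˡ : ∀ a {f g} → f ≋ g → a ·ₚ f ≋ a ·ₚ g
  ·ₚ-congˡ a = ·ₚ-cong refl

  ·ₚ-congʳ : ∀ {a b} f → a ≈ b → a ·ₚ f ≋ b ·ₚ f
  ·ₚ-congʳ f e = ·ₚ-cong e (≋-refl {f})

  ∷-cong : ∀ {a b f g} → a ≈ b → f ≋ g → (a ∷ f) ≋ (b ∷ g)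
  ∷-cong e p = coeffwise λ { zero → e ; (suc n) → coeff≈ p n }

  ∷-injectiveʳ : ∀ {a b f g} → (a ∷ f) ≋ (b ∷ g) → f ≋ g
  ∷-injectiveʳ p = coeffwise λ n → coeff≈ p (suc n)

  ∷≋[]⇒≋[] : ∀ {a f} → (a ∷ f) ≋ [] → f ≋ []
  ∷≋[]⇒≋[] p = coeffwise λ n → coeff≈ p (suc n)

  const-cong : ∀ {a b} → a ≈ b → const a ≋ const b
  const-cong e = ∷-cong e ≋-refl

  ·ₚ-assoc : ∀ a b f → a ·ₚ (b ·ₚ f) ≋ (a * b) ·ₚ f
  ·ₚ-assoc a b f = coeffwise λ n → begin
    coeff (a ·ₚ (b ·ₚ f)) n ≈⟨ coeff-·ₚ a (b ·ₚ f) n ⟩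
    a * coeff (b ·ₚ f) n    ≈⟨ *-congˡ (coeff-·ₚ b f n) ⟩
    a * (b * coeff f n)     ≈⟨ *-assoc a b _ ⟨
    (a * b) * coeff f n     ≈⟨ coeff-·ₚ (a * b) f n ⟨
    coeff ((a * b) ·ₚ f) n  ∎
    where open ≈-Reasoning

  ·ₚ-identityˡ : ∀ f → 1# ·ₚ f ≋ f
  ·ₚ-identityˡ f = coeffwise λ n → trans (coeff-·ₚ 1# f n) (*-identityˡ _)

  ·ₚ-distribˡ-+ₚ : ∀ a f g → a ·ₚ (f +ₚ g) ≋ a ·ₚ f +ₚ a ·ₚ g
  ·ₚ-distribˡ-+ₚ a f g = coeffwise λ n → begin
    coeff (a ·ₚ (f +ₚ g)) n             ≈⟨ coeff-·ₚ a (f +ₚ g) n ⟩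
    a * coeff (f +ₚ g) n                ≈⟨ *-congˡ (coeff-+ₚ f g n) ⟩
    a * (coeff f n + coeff g n)         ≈⟨ distribˡ a _ _ ⟩
    a * coeff f n + a * coeff g n       ≈⟨ +-cong (coeff-·ₚ a f n) (coeff-·ₚ a g n) ⟨
    coeff (a ·ₚ f) n + coeff (a ·ₚ g) n ≈⟨ coeff-+ₚ (a ·ₚ f) (a ·ₚ g) n ⟨
    coeff (a ·ₚ f +ₚ a ·ₚ g) n          ∎
    where open ≈-Reasoning

  *ₚ-congˡ : ∀ f {g h} → g ≋ h → f *ₚ g ≋ f *ₚ h
  *ₚ-congˡ [] p = ≋-refl
  *ₚ-congˡ (a ∷ f) p = +ₚ-cong (·ₚ-cong refl p) (∷-cong refl (*ₚ-congˡ f p))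

  *ₚ-zeroʳ : ∀ f → f *ₚ [] ≋ []
  *ₚ-zeroʳ [] = ≋-refl
  *ₚ-zeroʳ (a ∷ f) = coeffwise λ { zero → refl ; (suc n) → coeff≈ (*ₚ-zeroʳ f) n }

  +ₚ-identityʳ : ∀ f → f +ₚ [] ≋ f
  +ₚ-identityʳ [] = ≋-refl
  +ₚ-identityʳ (a ∷ f) = ≋-refl

  +ₚ-assoc : ∀ f g h → (f +ₚ g) +ₚ h ≋ f +ₚ (g +ₚ h)
  +ₚ-assoc f g h = coeffwise λ n → begin
    coeff ((f +ₚ g) +ₚ h) n                 ≈⟨ trans (coeff-+ₚ (f +ₚ g) h n) (+-congʳ (coeff-+ₚ f g n)) ⟩
    (coeff f n + coeff g n) + coeff h n     ≈⟨ +-assoc _ _ _ ⟩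
    coeff f n + (coeff g n + coeff h n)     ≈⟨ trans (coeff-+ₚ f (g +ₚ h) n) (+-congˡ (coeff-+ₚ g h n)) ⟨
    coeff (f +ₚ (g +ₚ h)) n                 ∎
    where open ≈-Reasoning

  +ₚ-neg-·ₚ-cancelʳ : ∀ f r h → (f +ₚ (- r) ·ₚ h) +ₚ r ·ₚ h ≋ f
  +ₚ-neg-·ₚ-cancelʳ f r h = coeffwise λ n → begin
    coeff ((f +ₚ (- r) ·ₚ h) +ₚ r ·ₚ h) n    ≈⟨ coeff-+ₚ (f +ₚ (- r) ·ₚ h) _ n ⟩
    coeff (f +ₚ (- r) ·ₚ h) n + coeff (r ·ₚ h) n
      ≈⟨ +-cong (trans (coeff-+ₚ f _ n) (+-congˡ (coeff-·ₚ (- r) h n))) (coeff-·ₚ r h n) ⟩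
    (coeff f n + (- r) * coeff h n) + r * coeff h n ≈⟨ +-assoc _ _ _ ⟩
    coeff f n + ((- r) * coeff h n + r * coeff h n) ≈⟨ +-congˡ (distribʳ (coeff h n) (- r) r) ⟨
    coeff f n + (- r + r) * coeff h n       ≈⟨ +-congˡ (trans (*-congʳ (-‿inverseˡ r)) (zeroˡ _)) ⟩
    coeff f n + 0#                          ≈⟨ +-identityʳ _ ⟩
    coeff f n                               ∎
    where open ≈-Reasoning

  eval-[] : ∀ z {f} → f ≋ [] → eval z f ≈ 0#
  eval-[] z {[]} p = refl
  eval-[] z {a ∷ f} p = begin
    a + z * eval z f ≈⟨ +-cong (coeff≈ p zero) (*-congˡ (eval-[] z (∷≋[]⇒≋[] p))) ⟩
    0# + z * 0#      ≈⟨ +-identityˡ _ ⟩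
    z * 0#           ≈⟨ zeroʳ z ⟩
    0#               ∎
    where open ≈-Reasoning

  eval-cong : ∀ z {f g} → f ≋ g → eval z f ≈ eval z g
  eval-cong z {[]} p = sym (eval-[] z (≋-sym p))
  eval-cong z {a ∷ f} {[]} p = eval-[] z p
  eval-cong z {a ∷ f} {b ∷ g} p =
    +-cong (coeff≈ p zero) (*-congˡ (eval-cong z (∷-injectiveʳ p)))

  eval-+ₚ : ∀ z f g → eval z (f +ₚ g) ≈ eval z f + eval z g
  eval-+ₚ z [] g = sym (+-identityˡ _)
  eval-+ₚ z (a ∷ f) [] = sym (+-identityʳ _)
  eval-+ₚ z (a ∷ f) (b ∷ g) = begin
    (a + b) + z * eval z (f +ₚ g)           ≈⟨ +-congˡ (*-congˡ (eval-+ₚ z f g)) ⟩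
    (a + b) + z * (eval z f + eval z g)     ≈⟨ +-congˡ (distribˡ z _ _) ⟩
    (a + b) + (z * eval z f + z * eval z g) ≈⟨ interchange a b _ _ ⟩
    (a + z * eval z f) + (b + z * eval z g) ∎
    where open ≈-Reasoning

  eval-·ₚ : ∀ z a f → eval z (a ·ₚ f) ≈ a * eval z f
  eval-·ₚ z a [] = sym (zeroʳ a)
  eval-·ₚ z a (b ∷ f) = begin
    a * b + z * eval z (a ·ₚ f) ≈⟨ +-congˡ (*-congˡ (eval-·ₚ z a f)) ⟩
    a * b + z * (a * eval z f)  ≈⟨ +-congˡ (x∙yz≈y∙xz z a _) ⟩
    a * b + a * (z * eval z f)  ≈⟨ distribˡ a b _ ⟨
    a * (b + z * eval z f)      ∎
    where open ≈-Reasoning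

  eval-const : ∀ z a → eval z (const a) ≈ a
  eval-const z a = trans (+-congˡ (zeroʳ z)) (+-identityʳ a)

  -- Degree bounds

  record DegreeBelow (f : Pol) (n : ℕ) : Set ℓ where
    constructor degreeBelow
    field vanishes : ∀ m → n ≤ m → coeff f m ≈ 0#
  open DegreeBelow

  hasDeg⇒degreeBelow : ∀ {f n} → HasDeg f n → DegreeBelow f (suc n)
  hasDeg⇒degreeBelow (_ , higher) = degreeBelow higher

  degreeBelow-mono : ∀ {f m n} → m ≤ n → DegreeBelow f m → DegreeBelow f n
  degreeBelow-mono m≤n df = degreeBelow λ k n≤k → vanishes df k (ℕ.≤-trans m≤n n≤k)

  degreeBelow-resp : ∀ {f g n} → f ≋ g → DegreeBelow g n → DegreeBelow f n
  degreeBelow-resp p dg = degreeBelow λ m n≤m → trans (coeff≈ p m) (vanishes dg m n≤m)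

  degreeBelow-·ₚ : ∀ a {f n} → DegreeBelow f n → DegreeBelow (a ·ₚ f) n
  degreeBelow-·ₚ a {f} df = degreeBelow λ m n≤m →
    trans (coeff-·ₚ a f m) (trans (*-congˡ (vanishes df m n≤m)) (zeroʳ a))

  degreeBelow-+ₚ : ∀ {f g n} → DegreeBelow f n → DegreeBelow g n → DegreeBelow (f +ₚ g) n
  degreeBelow-+ₚ {f} {g} df dg = degreeBelow λ m n≤m →
    trans (coeff-+ₚ f g m) (trans (+-cong (vanishes df m n≤m) (vanishes dg m n≤m)) (+-identityʳ 0#))

  degreeBelow-1 : ∀ {f} → DegreeBelow f 1 → f ≋ const (coeff f 0)
  degreeBelow-1 df = coeffwise λ { zero → refl ; (suc m) → vanishes df (suc m) (s≤s z≤n) }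

  monomial : ℕ → Pol
  monomial zero = const 1#
  monomial (suc n) = 0# ∷ monomial n

  monomial-hasDeg : ∀ n → HasDeg (monomial n) n
  monomial-hasDeg n = (λ e → 1≉0 (trans (sym (leading n)) e)) , vanishing n
    where
    leading : ∀ n → coeff (monomial n) n ≈ 1#
    leading zero = refl
    leading (suc n) = leading n
    vanishing : ∀ n m → n < m → coeff (monomial n) m ≈ 0#
    vanishing zero (suc m) _ = refl
    vanishing (suc n) (suc m) (s≤s n<m) = vanishing n m n<m

  shift-[] : ∀ a {f} → f ≋ [] → shift a f ≋ []
  shift-[] a {[]} p = ≋-refl
  shift-[] a {b ∷ f} p = ≋-trans
    (+ₚ-cong (const-cong (coeff≈ p zero))
             (≋-trans (*ₚ-congˡ (a ∷ 1# ∷ []) (shift-[] a (∷≋[]⇒≋[] p))) (*ₚ-zeroʳ (a ∷ 1# ∷ []))))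
    (coeffwise λ { zero → refl ; (suc n) → refl })

  shift-cong : ∀ a {f g} → f ≋ g → shift a f ≋ shift a g
  shift-cong a {[]} p = ≋-sym (shift-[] a (≋-sym p))
  shift-cong a {_ ∷ _} {[]} p = shift-[] a p
  shift-cong a {_ ∷ _} {_ ∷ _} p =
    +ₚ-cong (const-cong (coeff≈ p zero)) (*ₚ-congˡ (a ∷ 1# ∷ []) (shift-cong a (∷-injectiveʳ p)))

  shift-const : ∀ a b → shift a (const b) ≋ const b
  shift-const a b = coeffwise λ { zero → +-identityʳ b ; (suc zero) → refl ; (suc (suc n)) → refl }

  shift-X : ∀ a → shift a X ≋ X +ₚ const a
  shift-X a = coeffwise λ
    { zero → +-congˡ (trans (+-identityʳ _) (trans (*-congˡ (+-identityʳ 1#)) (*-identityʳ a)))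
    ; (suc zero) → begin
        a * 0# + (1# * (1# + 0#) + 0#) ≈⟨ +-cong (zeroʳ a) (+-identityʳ _) ⟩
        0# + 1# * (1# + 0#)           ≈⟨ +-identityˡ _ ⟩
        1# * (1# + 0#)                ≈⟨ *-identityˡ _ ⟩
        1# + 0#                       ≈⟨ +-identityʳ 1# ⟩
        1#                            ∎
    ; (suc (suc zero)) → zeroʳ 1#
    ; (suc (suc (suc n))) → refl
    }
    where open ≈-Reasoning

  module _ {T : Op} (T-linear : IsLinear T) where
    open IsLinear T-linear

    linear-cong : ∀ {f g} → f ≋ g → T f ≋ T g
    linear-cong {f} {g} p = coeffwise (cong f g (coeff≈ p))

    linear-+ₚ : ∀ f g → T (f +ₚ g) ≋ T f +ₚ T g
    linear-+ₚ f g = coeffwise (additive f g)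

    linear-·ₚ : ∀ a f → T (a ·ₚ f) ≋ a ·ₚ T f
    linear-·ₚ a f = coeffwise (homogeneous a f)

    linear-[] : T [] ≋ []
    linear-[] = ≋-trans (linear-·ₚ 0# []) (coeffwise λ n → trans (coeff-·ₚ 0# (T []) n) (zeroˡ _))

    iter-cong : ∀ i {f g} → f ≋ g → iter i T f ≋ iter i T g
    iter-cong zero p = p
    iter-cong (suc i) p = linear-cong (iter-cong i p)

    iter-·ₚ : ∀ i a f → iter i T (a ·ₚ f) ≋ a ·ₚ iter i T f
    iter-·ₚ zero a f = ≋-refl
    iter-·ₚ (suc i) a f = ≋-trans (linear-cong (iter-·ₚ i a f)) (linear-·ₚ a (iter i T f))

  iter-sucʳ : ∀ (T : Op) i f → iter (suc i) T f ≡.≡ iter i T (T f)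
  iter-sucʳ T zero f = ≡.refl
  iter-sucʳ T (suc i) f = ≡.cong T (iter-sucʳ T i f)

  -- D (X + a) = D (shift a X) = shift a (D X) = D X, as D X is constant.
  delta-const : ∀ {D} → IsDeltaOperator D → ∀ a → D (const a) ≋ []
  delta-const {D} ((D-linear , D-shift) , α , _ , DX≈ₚα) a = coeffwise λ n →
    identityʳ-unique (coeff (D X) n) _ (trans (sym (coeff-+ₚ (D X) (D (const a)) n)) (coeff≈ DX+Da≋DX n))
    where
    DX≋α : D X ≋ const α
    DX≋α = coeffwise DX≈ₚα
    DX+Da≋DX : D X +ₚ D (const a) ≋ D X
    DX+Da≋DX = begin
      D X +ₚ D (const a)  ≈⟨ linear-+ₚ D-linear X (const a) ⟨
      D (X +ₚ const a)    ≈⟨ linear-cong D-linear (shift-X a) ⟨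
      D (shift a X)       ≈⟨ coeffwise (D-shift a X) ⟩
      shift a (D X)       ≈⟨ shift-cong a DX≋α ⟩
      shift a (const α)   ≈⟨ shift-const a α ⟩
      const α             ≈⟨ DX≋α ⟨
      D X                 ∎
      where open ≋-Reasoning

  1-ε-cong : ∀ z {f g} → f ≋ g → 1-ε z f ≋ 1-ε z g
  1-ε-cong z p = +ₚ-cong p (const-cong (-‿cong (eval-cong z p)))

  1-ε-·ₚ : ∀ z a f → 1-ε z (a ·ₚ f) ≋ a ·ₚ 1-ε z f
  1-ε-·ₚ z a f = begin
    a ·ₚ f +ₚ const (- eval z (a ·ₚ f))  ≈⟨ +ₚ-congˡ (a ·ₚ f) (const-cong (-‿cong (eval-·ₚ z a f))) ⟩
    a ·ₚ f +ₚ const (- (a * eval z f))   ≈⟨ +ₚ-congˡ (a ·ₚ f) (const-cong (-‿distribʳ-* a _)) ⟩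
    a ·ₚ f +ₚ a ·ₚ const (- eval z f)    ≈⟨ ·ₚ-distribˡ-+ₚ a f _ ⟨
    a ·ₚ 1-ε z f                         ∎
    where open ≋-Reasoning

  eval-1-ε : ∀ z f → eval z (1-ε z f) ≈ 0#
  eval-1-ε z f = begin
    eval z (f +ₚ const (- eval z f))         ≈⟨ eval-+ₚ z f _ ⟩
    eval z f + eval z (const (- eval z f))   ≈⟨ +-congˡ (eval-const z _) ⟩
    eval z f + - eval z f                    ≈⟨ -‿inverseʳ _ ⟩
    0#                                       ∎
    where open ≈-Reasoning

  degreeBelow-1-ε : ∀ z {f n} → DegreeBelow f (suc n) → DegreeBelow (1-ε z f) (suc n)
  degreeBelow-1-ε z {f} df = degreeBelow λ { (suc m) n<m →
    trans (coeff-+ₚ f _ (suc m)) (trans (+-identityʳ _) (vanishes df (suc m) n<m)) }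

  -- Right inverses of 𝔡

  module _ {Dinv : Op} (Dinv-linear : IsLinear Dinv) where

    const+Dinv-determined : ∀ z {a a' g g'} → g ≋ g' →
      eval z (const a +ₚ Dinv g) ≈ eval z (const a' +ₚ Dinv g') →
      const a +ₚ Dinv g ≋ const a' +ₚ Dinv g'
    const+Dinv-determined z {a} {a'} {g} {g'} g≋g' same-value =
      +ₚ-cong (const-cong a≈a') (linear-cong Dinv-linear g≋g')
      where
      value : ∀ a g → eval z (const a +ₚ Dinv g) ≈ a + eval z (Dinv g)
      value a g = trans (eval-+ₚ z (const a) (Dinv g)) (+-congʳ (eval-const z a))
      a≈a' : a ≈ a'
      a≈a' = ∙-cancelʳ (eval z (Dinv g')) a a' (begin
        a + eval z (Dinv g')   ≈⟨ +-congˡ (eval-cong z (linear-cong Dinv-linear g≋g')) ⟨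
        a + eval z (Dinv g)    ≈⟨ value a g ⟨
        eval z (const a +ₚ Dinv g)   ≈⟨ same-value ⟩
        eval z (const a' +ₚ Dinv g') ≈⟨ value a' g' ⟩
        a' + eval z (Dinv g')  ∎)
        where open ≈-Reasoning

    Iop-cong : ∀ z k {f g} → f ≋ g → Iop Dinv z k f ≋ Iop Dinv z k g
    Iop-cong z zero p = p
    Iop-cong z (suc k) p = Iop-cong z k (1-ε-cong (z k) (linear-cong Dinv-linear p))

    Iop-·ₚ : ∀ z k a f → Iop Dinv z k (a ·ₚ f) ≋ a ·ₚ Iop Dinv z k f
    Iop-·ₚ z zero a f = ≋-refl
    Iop-·ₚ z (suc k) a f = ≋-trans
      (Iop-cong z k (≋-trans (1-ε-cong (z k) (linear-·ₚ Dinv-linear a f)) (1-ε-·ₚ (z k) a (Dinv f))))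
      (Iop-·ₚ z k a (1-ε (z k) (Dinv f)))

    module _ (Dinv-raises : ∀ f n → HasDeg f n → HasDeg (Dinv f) (suc n)) where
      lower-leading : ∀ n f → DegreeBelow f (suc (suc n)) →
        ∃ λ r → DegreeBelow (f +ₚ (- r) ·ₚ Dinv (monomial n)) (suc n)
      lower-leading n f df = r , lowered
        where
        h : Pol
        h = Dinv (monomial n)
        h-hasDeg : HasDeg h (suc n)
        h-hasDeg = Dinv-raises (monomial n) n (monomial-hasDeg n)
        b⁻¹ : Carrier
        b⁻¹ = proj₁ (inverse _ (proj₁ h-hasDeg))
        r : Carrier
        r = coeff f (suc n) * b⁻¹
        r-leading : r * coeff h (suc n) ≈ coeff f (suc n)
        r-leading = begin
          (coeff f (suc n) * b⁻¹) * coeff h (suc n) ≈⟨ xy∙z≈x∙zy _ _ _ ⟩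
          coeff f (suc n) * (coeff h (suc n) * b⁻¹) ≈⟨ *-congˡ (proj₂ (inverse _ (proj₁ h-hasDeg))) ⟩
          coeff f (suc n) * 1#                      ≈⟨ *-identityʳ _ ⟩
          coeff f (suc n)                           ∎
          where open ≈-Reasoning
        lowered : DegreeBelow (f +ₚ (- r) ·ₚ h) (suc n)
        lowered = degreeBelow λ m n<m →
          trans (coeff-+ₚ f _ m) (trans (+-congˡ (coeff-·ₚ (- r) h m)) (top-cancels m n<m))
          where
          top-cancels : ∀ m → suc n ≤ m → coeff f m + (- r) * coeff h m ≈ 0#
          top-cancels m n<m with ℕ.m≤n⇒m<n∨m≡n n<m
          ... | inj₁ n+1<m = trans (+-cong (vanishes df m n+1<m) (*-congˡ (proj₂ h-hasDeg m n+1<m)))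
                                   (trans (+-identityˡ _) (zeroʳ _))
          ... | inj₂ ≡.refl = trans (+-congˡ (trans (sym (-‿distribˡ-* r _)) (-‿cong r-leading)))
                                    (-‿inverseʳ _)

      const+Dinv-decompose : ∀ n f → DegreeBelow f (suc n) →
        ∃₂ λ a g → DegreeBelow g n × f ≋ const a +ₚ Dinv g
      const+Dinv-decompose zero f df =
        coeff f 0 , [] , degreeBelow (λ _ _ → refl) ,
        ≋-trans (degreeBelow-1 df) (≋-sym (+ₚ-congˡ (const (coeff f 0)) (linear-[] Dinv-linear)))
      const+Dinv-decompose (suc n) f df with lower-leading n f df
      ... | r , lowered with const+Dinv-decompose n _ lowered
      ... | a , g , dg , f'≋ = a , g +ₚ r ·ₚ monomial n ,
        degreeBelow-+ₚ (degreeBelow-mono (ℕ.n≤1+n n) dg)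
                       (degreeBelow-·ₚ r (hasDeg⇒degreeBelow (monomial-hasDeg n))) , (begin
        f                                              ≈⟨ +ₚ-neg-·ₚ-cancelʳ f r h ⟨
        (f +ₚ (- r) ·ₚ h) +ₚ r ·ₚ h                    ≈⟨ +ₚ-cong f'≋ ≋-refl ⟩
        (const a +ₚ Dinv g) +ₚ r ·ₚ h                  ≈⟨ +ₚ-assoc (const a) (Dinv g) (r ·ₚ h) ⟩
        const a +ₚ (Dinv g +ₚ r ·ₚ h)
          ≈⟨ +ₚ-congˡ (const a) (+ₚ-congˡ (Dinv g) (linear-·ₚ Dinv-linear r (monomial n))) ⟨
        const a +ₚ (Dinv g +ₚ Dinv (r ·ₚ monomial n))  ≈⟨ +ₚ-congˡ (const a) (linear-+ₚ Dinv-linear g _) ⟨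
        const a +ₚ Dinv (g +ₚ r ·ₚ monomial n)         ∎)
        where
        open ≋-Reasoning
        h : Pol
        h = Dinv (monomial n)

  -- Gončarov interpolation

  module Interpolation {D Dinv : Op} (D-linear : IsLinear D) (D-const : ∀ a → D (const a) ≋ [])
           (Dinv-linear : IsLinear Dinv) (D∘Dinv : ∀ f → D (Dinv f) ≋ f)
           (Dinv-raises : ∀ f n → HasDeg f n → HasDeg (Dinv f) (suc n)) where

    D-const+Dinv : ∀ a g → D (const a +ₚ Dinv g) ≋ g
    D-const+Dinv a g = ≋-trans (linear-+ₚ D-linear (const a) (Dinv g)) (+ₚ-cong (D-const a) (D∘Dinv g))

    D-1-ε : ∀ z f → D (1-ε z f) ≋ D f
    D-1-ε z f = begin
      D (f +ₚ const (- eval z f))       ≈⟨ linear-+ₚ D-linear f _ ⟩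
      D f +ₚ D (const (- eval z f))     ≈⟨ +ₚ-congˡ (D f) (D-const _) ⟩
      D f +ₚ []                         ≈⟨ +ₚ-identityʳ (D f) ⟩
      D f                               ∎
      where open ≋-Reasoning

    interpolation-unique : ∀ n (w : ℕ → Carrier) {q q'} →
      DegreeBelow q (suc n) → DegreeBelow q' (suc n) →
      (∀ i → eval (w i) (iter i D q) ≈ eval (w i) (iter i D q')) → q ≋ q'
    interpolation-unique zero w {q} {q'} dq dq' agree = begin
      q                  ≈⟨ degreeBelow-1 dq ⟩
      const (coeff q 0)  ≈⟨ const-cong (trans (sym (value dq)) (trans (agree 0) (value dq'))) ⟩
      const (coeff q' 0) ≈⟨ degreeBelow-1 dq' ⟨
      q'                 ∎
      where
      open ≋-Reasoning
      value : ∀ {p} → DegreeBelow p 1 → eval (w 0) p ≈ coeff p 0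
      value dp = trans (eval-cong (w 0) (degreeBelow-1 dp)) (eval-const (w 0) _)
    interpolation-unique (suc n) w {q} {q'} dq dq' agree
      with const+Dinv-decompose Dinv-linear Dinv-raises (suc n) q dq
         | const+Dinv-decompose Dinv-linear Dinv-raises (suc n) q' dq'
    ... | a , g , dg , q≋ | a' , g' , dg' , q'≋ = begin
      q                   ≈⟨ q≋ ⟩
      const a +ₚ Dinv g   ≈⟨ const+Dinv-determined Dinv-linear (w 0) g≋g'
                               (trans (eval-cong (w 0) (≋-sym q≋)) (trans (agree 0) (eval-cong (w 0) q'≋))) ⟩
      const a' +ₚ Dinv g' ≈⟨ q'≋ ⟨
      q'                  ∎
      where
      open ≋-Reasoning
      Dq≋g : D q ≋ g
      Dq≋g = ≋-trans (linear-cong D-linear q≋) (D-const+Dinv a g)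
      Dq'≋g' : D q' ≋ g'
      Dq'≋g' = ≋-trans (linear-cong D-linear q'≋) (D-const+Dinv a' g')
      g≋g' : g ≋ g'
      g≋g' = ≋-trans (≋-sym Dq≋g) (≋-trans Dq≋Dq' Dq'≋g')
        where
        Dq≋Dq' : D q ≋ D q'
        Dq≋Dq' = interpolation-unique n (λ i → w (suc i))
          (degreeBelow-resp Dq≋g dg) (degreeBelow-resp Dq'≋g' dg')
          λ i → ≡.subst₂ (λ u v → eval (w (suc i)) u ≈ eval (w (suc i)) v)
                  (iter-sucʳ D i q) (iter-sucʳ D i q') (agree (suc i))

    goncarov-resp-grid : ∀ w w' (s : ℕ → Pol) → (∀ i → w i ≡.≡ w' i) →
      IsGoncarovBasis D w s → IsGoncarovBasis D w' s
    goncarov-resp-grid w w' s w≡w' (s-deg , s-val) =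
      s-deg , λ i n → ≡.subst (λ x → eval x (iter i D (s n)) ≈ _) (w≡w' i) (s-val i n)

    goncarov-unique : ∀ w (s s' : ℕ → Pol) → IsGoncarovBasis D w s → IsGoncarovBasis D w s' →
      ∀ n → s n ≋ s' n
    goncarov-unique w s s' (s-deg , s-val) (s'-deg , s'-val) n =
      interpolation-unique n w (hasDeg⇒degreeBelow (s-deg n)) (hasDeg⇒degreeBelow (s'-deg n))
        λ i → trans (s-val i n) (sym (s'-val i n))

    goncarov-recurrence : ∀ w (s s' : ℕ → Pol) →
      IsGoncarovBasis D w s → IsGoncarovBasis D (λ i → w (suc i)) s' →
      ∀ m → s (suc m) ≋ fromℕ (suc m) ·ₚ 1-ε (w 0) (Dinv (s' m))
    goncarov-recurrence w s s' (s-deg , s-val) (s'-deg , s'-val) m =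
      interpolation-unique (suc m) w (hasDeg⇒degreeBelow (s-deg (suc m))) rhs-degree agree
      where
      r : Carrier
      r = fromℕ (suc m)
      p : Pol
      p = 1-ε (w 0) (Dinv (s' m))
      rhs-degree : DegreeBelow (r ·ₚ p) (suc (suc m))
      rhs-degree =
        degreeBelow-·ₚ r (degreeBelow-1-ε (w 0) (hasDeg⇒degreeBelow (Dinv-raises (s' m) m (s'-deg m))))
      D-rhs : D (r ·ₚ p) ≋ r ·ₚ s' m
      D-rhs = begin
        D (r ·ₚ p)              ≈⟨ linear-·ₚ D-linear r p ⟩
        r ·ₚ D p                ≈⟨ ·ₚ-congˡ r (D-1-ε (w 0) _) ⟩
        r ·ₚ D (Dinv (s' m))    ≈⟨ ·ₚ-congˡ r (D∘Dinv (s' m)) ⟩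
        r ·ₚ s' m               ∎
        where open ≋-Reasoning
      agree : ∀ i → eval (w i) (iter i D (s (suc m))) ≈ eval (w i) (iter i D (r ·ₚ p))
      agree zero = begin
        eval (w 0) (s (suc m))     ≈⟨ s-val 0 (suc m) ⟩
        fromℕ (fact (suc m)) * 0#  ≈⟨ zeroʳ _ ⟩
        0#                         ≈⟨ zeroʳ r ⟨
        r * 0#                     ≈⟨ *-congˡ (eval-1-ε (w 0) (Dinv (s' m))) ⟨
        r * eval (w 0) p           ≈⟨ eval-·ₚ (w 0) r p ⟨
        eval (w 0) (r ·ₚ p)        ∎
        where open ≈-Reasoning
      agree (suc i) = begin
        eval (w (suc i)) (iter (suc i) D (s (suc m)))  ≈⟨ s-val (suc i) (suc m) ⟩
        fromℕ (fact (suc m)) * kronecker i m         ≈⟨ *-congʳ (fromℕ-* (suc m) (fact m)) ⟩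
        (r * fromℕ (fact m)) * kronecker i m         ≈⟨ *-assoc r _ _ ⟩
        r * (fromℕ (fact m) * kronecker i m)         ≈⟨ *-congˡ (s'-val i m) ⟨
        r * eval (w (suc i)) (iter i D (s' m))       ≈⟨ eval-·ₚ (w (suc i)) r (iter i D (s' m)) ⟨
        eval (w (suc i)) (r ·ₚ iter i D (s' m))      ≈⟨ eval-cong (w (suc i)) (iter-·ₚ D-linear i r (s' m)) ⟨
        eval (w (suc i)) (iter i D (r ·ₚ s' m))      ≈⟨ eval-cong (w (suc i)) (iter-cong D-linear i D-rhs) ⟨
        eval (w (suc i)) (iter i D (D (r ·ₚ p)))     ≡⟨ ≡.cong (eval (w (suc i))) (iter-sucʳ D i (r ·ₚ p)) ⟨
        eval (w (suc i)) (iter (suc i) D (r ·ₚ p))   ∎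
        where open ≈-Reasoning

    goncarov-iterated : ∀ z (t : ℕ → Pol) (tk : ℕ → ℕ → Pol) → IsGoncarovBasis D z t →
      (∀ k → IsGoncarovBasis D (λ i → z (i +ℕ k)) (tk k)) →
      ∀ n k → k ≤ n → t n ≋ fromℕ (falling n k) ·ₚ Iop Dinv z k (tk k (n ∸ k))
    goncarov-iterated z t tk t-basis tk-basis n zero _ = begin
      t n                ≈⟨ goncarov-unique z t (tk 0) t-basis tk0-basis n ⟩
      tk 0 n             ≈⟨ ·ₚ-identityˡ (tk 0 n) ⟨
      1# ·ₚ tk 0 n       ≈⟨ ·ₚ-congʳ (tk 0 n) (+-identityʳ 1#) ⟨
      fromℕ 1 ·ₚ tk 0 n  ∎
      where
      open ≋-Reasoning
      tk0-basis : IsGoncarovBasis D z (tk 0)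
      tk0-basis = goncarov-resp-grid _ z (tk 0) (λ i → ≡.cong z (ℕ.+-identityʳ i)) (tk-basis 0)
    goncarov-iterated z t tk t-basis tk-basis n (suc k) k<n = begin
      t n                                ≈⟨ goncarov-iterated z t tk t-basis tk-basis n k (ℕ.<⇒≤ k<n) ⟩
      F ·ₚ Iop Dinv z k (tk k (n ∸ k))   ≈⟨ ·ₚ-congˡ F (Iop-cong Dinv-linear z k step) ⟩
      F ·ₚ Iop Dinv z k (r ·ₚ Q)         ≈⟨ ·ₚ-congˡ F (Iop-·ₚ Dinv-linear z k r Q) ⟩
      F ·ₚ (r ·ₚ Iop Dinv z k Q)         ≈⟨ ·ₚ-assoc F r _ ⟩
      (F * r) ·ₚ Iop Dinv z k Q
        ≈⟨ ·ₚ-congʳ _ (trans (*-comm F r) (sym (fromℕ-* (n ∸ k) (falling n k)))) ⟩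
      fromℕ (falling n (suc k)) ·ₚ Iop Dinv z (suc k) (tk (suc k) (n ∸ suc k)) ∎
      where
      open ≋-Reasoning
      F r : Carrier
      F = fromℕ (falling n k)
      r = fromℕ (n ∸ k)
      Q : Pol
      Q = 1-ε (z k) (Dinv (tk (suc k) (n ∸ suc k)))
      step : tk k (n ∸ k) ≋ r ·ₚ Q
      step = ≡.subst (λ j → tk k j ≋ fromℕ j ·ₚ Q) (≡.sym (ℕ.+-∸-assoc 1 k<n))
        (goncarov-recurrence (λ i → z (i +ℕ k)) (tk k) (tk (suc k)) (tk-basis k)
          (goncarov-resp-grid _ _ (tk (suc k)) (λ i → ≡.cong z (ℕ.+-suc i k)) (tk-basis (suc k)))
          (n ∸ suc k))

proposition3p11 :
    ∀ {c ℓ} (K : Field c ℓ) → let open Field K in let open Poly K in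
    CharZero →
    (D Dinv : Op) → IsDeltaOperator D →
    IsLinear Dinv →
    (∀ f → D (Dinv f) ≈ₚ f) →
    (∀ f n → HasDeg f n → HasDeg (Dinv f) (suc n)) →
    (∀ f → eval 0# (Dinv f) ≈ 0#) →
    (z : ℕ → Carrier) →
    (t : ℕ → Pol) → IsGoncarovBasis D z t →
    (tk : ℕ → ℕ → Pol) → (∀ k → IsGoncarovBasis D (λ i → z (i +ℕ k)) (tk k)) →
    ∀ n k → k ≤ n →
    t n ≈ₚ fromℕ (falling n k) ·ₚ Iop Dinv z k (tk k (n ∸ k))
proposition3p11 K _ D Dinv D-delta Dinv-linear D∘Dinv Dinv-raises _ z t t-basis tk tk-basis n k k≤n =
  coeff≈ (goncarov-iterated z t tk t-basis tk-basis n k k≤n)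
  where
  open GoncarovBases K
  open Interpolation (proj₁ (proj₁ D-delta)) (delta-const D-delta) Dinv-linear
                     (λ f → coeffwise (D∘Dinv f)) Dinv-raises
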